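{- Let $\mathbf t$ be an infinite word over $\mathcal A$, $a\in\mathcal A$, and $\mathbf s=\psi_a(\mathbf t)$. Then $D(\mathbf s)\ge D(\mathbf t)$; in particular, if $\mathbf s$ is almost rich then $\mathbf t$ is almost rich.
   Context: $\psi_a$ is the morphism $a\mapsto a$, $x\mapsto ax$ for every letter $x\ne a$. For a finite word $w$, $D(w)=|w|+1-|\mathrm{PAL}(w)|$, where $\mathrm{PAL}(w)$ is the set of distinct palindromic factors of $w$ (including the empty word); the defect $D$ of an infinite word is the supremum of the defects of its factors; an infinite word is almost rich if its defect is finite. -}

module Defs where

open import Data.Nat using (ℕ; zero; suc; _+_; _∸_; _≤_)
open import Data.Fin using (Fin; toℕ)
open import Data.List using (List; []; _∷_; length; take; drop; reverse; filter; deduplicate; concatMap; concat; map; tabulate; upTo)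
open import Data.List.Properties using (≡-dec)
open import Data.Product using (Σ; ∃; _×_)
open import Relation.Binary.PropositionalEquality using (_≡_)
open import Relation.Binary.Definitions using (DecidableEquality)
open import Relation.Nullary using (yes; no)

module _ {A : Set} (_≟_ : DecidableEquality A) where

  ψ : A → List A → List A
  ψ a = concatMap img
    where
    img : A → List A
    img x with x ≟ a
    ... | yes _ = a ∷ []
    ... | no  _ = a ∷ x ∷ []

  factorsList : List A → List (List A)
  factorsList w =
    concat (map (λ i → map (λ j → take j (drop i w)) (upTo (suc (length w ∸ i))))
                (upTo (suc (length w))))

  -- PAL(w): the distinct palindromic factors of w (including the empty word)
  PAL : List A → List (List A)
  PAL w = deduplicate (≡-dec _≟_)
            (filter (λ u → ≡-dec _≟_ (reverse u) u) (factorsList w))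

  D : List A → ℕ
  D w = suc (length w) ∸ length (PAL w)

  prefix : (ℕ → A) → ℕ → List A
  prefix x n = tabulate (λ (k : Fin n) → x (toℕ k))

  slice : (ℕ → A) → ℕ → ℕ → List A
  slice x i n = tabulate (λ (k : Fin n) → x (i + toℕ k))

  IsFactor : List A → (ℕ → A) → Set
  IsFactor w x = Σ ℕ λ i → slice x i (length w) ≡ w

  IsPsiImage : A → (ℕ → A) → (ℕ → A) → Set
  IsPsiImage a t s = ∀ n → prefix s (length (ψ a (prefix t n))) ≡ ψ a (prefix t n)

  -- D(s) ≥ D(t) for defects in ℕ ∪ {∞} (suprema over factors):
  -- every factor defect of t is bounded by some factor defect of s
  DefectGE : (ℕ → A) → (ℕ → A) → Set
  DefectGE s t = ∀ w → IsFactor w t → ∃ λ u → IsFactor u s × D w ≤ D u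

  -- almost rich: finite defect, i.e. defects of factors are bounded
  AlmostRich : (ℕ → A) → Set
  AlmostRich x = ∃ λ B → ∀ w → IsFactor w x → D w ≤ B

module Submission where

-- Write U(w) = ψ_a(w)·a.  For every factor w of t, U(w) is a factor of s
-- (the letter after w in t has an image starting with a), so it suffices to show
-- D(w) ≤ D(U(w)).  Since |U(w)| = |w| + 1 + #{letters of w different from a},
-- this amounts to  |PAL(U(w))| ≤ 1 + #{non-a letters of w} + |PAL(w)|.
-- We prove it by listing candidates containing every palindromic factor of U(w):
--   * the empty word;
--   * palindromes starting with a: they are exactly U(v) for palindromic factors v of w;
--   * palindromes y·p with y ≠ a: they lie between two a's in U(w), and a·y·p·a = U(y·r)
--     for a palindromic factor y·r of w with p = ψ_a(r); moreover y·r is the longest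
--     palindromic suffix of the prefix of w ending at its leftmost occurrence, a prefix
--     ending with the letter y ≠ a.  So there are at most #{non-a letters of w} of them.

open import Defs
open import Data.List using (List)
open import Data.List.Membership.Propositional using (_∈_)
open import Data.Nat using (ℕ)
open import Data.Product using (_×_)
open import Relation.Binary.Definitions using (DecidableEquality)

open import Data.Nat using (zero; suc; _+_; _∸_; _≤_; _<_; z≤n; s≤s; s≤s⁻¹)
open import Data.Nat.Properties
open import Data.Fin using (toℕ)
open import Data.List using ([]; _∷_; _++_; length; map; reverse; [_]; drop; take; upTo; filter)
open import Data.List.Properties
open import Data.List.Membership.Propositional.Properties
open import Data.List.Relation.Unary.All using (All; []; _∷_)
open import Data.List.Relation.Unary.Any using (here; there)
open import Data.List.Relation.Unary.Unique.Propositional using (Unique; _∷_)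
open import Data.List.Relation.Unary.Unique.DecPropositional.Properties using (deduplicate-!)
open import Data.Product using (Σ; _,_; proj₁; proj₂)
open import Data.Sum using (_⊎_; inj₁; inj₂)
open import Data.Empty using (⊥-elim)
open import Relation.Binary.PropositionalEquality hiding ([_])
open import Relation.Nullary using (¬_; yes; no)

module Lists {A : Set} where

  unique-⊆⇒length-≤ : (xs ys : List A) → Unique xs → (∀ {z} → z ∈ xs → z ∈ ys) →
                      length xs ≤ length ys
  unique-⊆⇒length-≤ [] ys _ _ = z≤n
  unique-⊆⇒length-≤ (x ∷ xs) ys (x∉xs ∷ uxs) xs⊆ys with ∈-∃++ (xs⊆ys (here refl))
  ... | l , r , refl = begin
      suc (length xs)         ≤⟨ s≤s (unique-⊆⇒length-≤ xs (l ++ r) uxs xs⊆l++r) ⟩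
      suc (length (l ++ r))   ≡⟨ cong suc (length-++ l) ⟩
      suc (length l + length r) ≡⟨ +-suc (length l) (length r) ⟨
      length l + suc (length r) ≡⟨ length-++ l ⟨
      length (l ++ x ∷ r)     ∎
    where
    open ≤-Reasoning
    distinct : ∀ {z} {zs : List A} → All (λ u → ¬ x ≡ u) zs → z ∈ zs → ¬ x ≡ z
    distinct (x≢u ∷ _) (here refl) = x≢u
    distinct (_ ∷ ps) (there z∈zs) = distinct ps z∈zs
    remove : ∀ {z} → z ∈ l ++ x ∷ r → ¬ x ≡ z → z ∈ l ++ r
    remove z∈ x≢z with ∈-++⁻ l z∈
    ... | inj₁ z∈l = ∈-++⁺ˡ z∈l
    ... | inj₂ (here refl) = ⊥-elim (x≢z refl)
    ... | inj₂ (there z∈r) = ∈-++⁺ʳ l z∈r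
    xs⊆l++r : ∀ {z} → z ∈ xs → z ∈ l ++ r
    xs⊆l++r z∈xs = remove (xs⊆ys (there z∈xs)) (distinct x∉xs z∈xs)

  ++-split : (xs ys zs ws : List A) → length xs ≡ length ys → xs ++ zs ≡ ys ++ ws →
             xs ≡ ys × zs ≡ ws
  ++-split [] [] zs ws _ eq = refl , eq
  ++-split (x ∷ xs) (y ∷ ys) zs ws len eq with ∷-injective eq
  ... | refl , eq′ with ++-split xs ys zs ws (suc-injective len) eq′
  ... | refl , zs≡ws = refl , zs≡ws

  shorter-suffix : (p r p′ q : List A) → p ++ r ≡ p′ ++ q → length r ≤ length q →
                   Σ (List A) λ m → q ≡ m ++ r
  shorter-suffix p r [] q eq _ = p , sym eq
  shorter-suffix [] r (y ∷ p′) q refl len =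
    ⊥-elim (<-irrefl refl (≤-trans (s≤s (length-++-≤ʳ q {p′})) len))
  shorter-suffix (x ∷ p) r (y ∷ p′) q eq len = shorter-suffix p r p′ q (∷-injectiveʳ eq) len

  []≢++∷ : (xs : List A) {y : A} {ys : List A} → ¬ [] ≡ xs ++ y ∷ ys
  []≢++∷ [] ()
  []≢++∷ (_ ∷ _) ()

open Lists

module Palindromes {A : Set} (_≟_ : DecidableEquality A) where

  Pal : List A → Set
  Pal z = reverse z ≡ z

  Factor : List A → List A → Set
  Factor u w = Σ (List A) λ p → Σ (List A) λ q → w ≡ p ++ u ++ q

  drop-length : (p x : List A) → drop (length p) (p ++ x) ≡ x
  drop-length [] x = refl
  drop-length (y ∷ p) x = drop-length p x

  take-length : (p x : List A) → take (length p) (p ++ x) ≡ p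
  take-length [] x = refl
  take-length (y ∷ p) x = cong (y ∷_) (take-length p x)

  factorsAt : List A → ℕ → List (List A)
  factorsAt w i = map (λ j → take j (drop i w)) (upTo (suc (length w ∸ i)))

  factorsList⁻ : ∀ {u} w → u ∈ factorsList _≟_ w → Factor u w
  factorsList⁻ {u} w u∈ with ∈-concat⁻′ (map (factorsAt w) (upTo (suc (length w)))) u∈
  ... | _ , u∈xs , xs∈ with ∈-map⁻ (factorsAt w) {xs = upTo (suc (length w))} xs∈
  ... | i , _ , refl with ∈-map⁻ (λ j → take j (drop i w)) {xs = upTo (suc (length w ∸ i))} u∈xs
  ... | j , _ , refl =
    take i w , drop j (drop i w) ,
    trans (sym (take++drop≡id i w)) (cong (take i w ++_) (sym (take++drop≡id j (drop i w))))

  factorsList⁺ : ∀ {u} w → Factor u w → u ∈ factorsList _≟_ w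
  factorsList⁺ {u} w (p , q , refl) =
    ∈-concat⁺′ u∈ (∈-map⁺ (factorsAt w) (∈-upTo⁺ i<))
    where
    |w| : length w ≡ length p + (length u + length q)
    |w| = trans (length-++ p) (cong (length p +_) (length-++ u))
    i< : length p < suc (length w)
    i< = s≤s (subst (length p ≤_) (sym |w|) (m≤m+n _ _))
    j< : length u < suc (length w ∸ length p)
    j< = s≤s (subst (length u ≤_) (sym (trans (cong (_∸ length p) |w|) (m+n∸m≡n (length p) _)))
                     (m≤m+n _ _))
    takes-u : take (length u) (drop (length p) w) ≡ u
    takes-u = trans (cong (take (length u)) (drop-length p (u ++ q))) (take-length u q)
    u∈ : u ∈ factorsAt w (length p)
    u∈ = subst (_∈ factorsAt w (length p)) takes-u
           (∈-map⁺ (λ j → take j (drop (length p) w)) (∈-upTo⁺ j<))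

  PAL⁻ : ∀ {u} w → u ∈ PAL _≟_ w → Pal u × Factor u w
  PAL⁻ w u∈ with ∈-filter⁻ (λ u → ≡-dec _≟_ (reverse u) u) (∈-deduplicate⁻ (≡-dec _≟_) _ u∈)
  ... | u∈fs , pal = pal , factorsList⁻ w u∈fs

  PAL⁺ : ∀ {u} w → Pal u → Factor u w → u ∈ PAL _≟_ w
  PAL⁺ w pal fac = ∈-deduplicate⁺ (≡-dec _≟_)
    (∈-filter⁺ (λ u → ≡-dec _≟_ (reverse u) u) (factorsList⁺ w fac) pal)

  PAL-unique : ∀ w → Unique (PAL _≟_ w)
  PAL-unique w = deduplicate-! (≡-dec _≟_)
    (filter (λ u → ≡-dec _≟_ (reverse u) u) (factorsList _≟_ w))

  lps : List A → List A
  lps [] = []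
  lps (x ∷ z) with ≡-dec _≟_ (reverse (x ∷ z)) (x ∷ z)
  ... | yes _ = x ∷ z
  ... | no _ = lps z

  lps-suffix : ∀ z → Σ (List A) λ p → z ≡ p ++ lps z
  lps-suffix [] = [] , refl
  lps-suffix (x ∷ z) with ≡-dec _≟_ (reverse (x ∷ z)) (x ∷ z)
  ... | yes _ = [] , refl
  ... | no _ with lps-suffix z
  ... | p , eq = x ∷ p , cong (x ∷_) eq

  lps-pal : ∀ z → Pal (lps z)
  lps-pal [] = refl
  lps-pal (x ∷ z) with ≡-dec _≟_ (reverse (x ∷ z)) (x ∷ z)
  ... | yes pal = pal
  ... | no _ = lps-pal z

  lps-longest : ∀ z p r → z ≡ p ++ r → Pal r → length r ≤ length (lps z)
  lps-longest [] [] [] _ _ = z≤n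
  lps-longest (x ∷ z) p r eq pal with ≡-dec _≟_ (reverse (x ∷ z)) (x ∷ z)
  ... | yes _ = subst (λ z′ → length r ≤ length z′) (sym eq) (length-++-≤ʳ r {p})
  lps-longest (x ∷ z) [] r refl pal | no ¬pal = ⊥-elim (¬pal pal)
  lps-longest (x ∷ z) (y ∷ p) r eq pal | no _ = lps-longest z p r (∷-injectiveʳ eq) pal

  -- A palindromic suffix r of z strictly shorter than another palindromic suffix q of z
  -- also occurs strictly earlier: mirroring r inside q gives an occurrence of r as a
  -- prefix of q.
  mirror-in-longer : ∀ z p r p′ q → z ≡ p ++ r → z ≡ p′ ++ q → Pal r → Pal q →
                     length r < length q →
                     Σ (List A) λ m → (z ≡ p′ ++ r ++ m) × 1 ≤ length m
  mirror-in-longer z p r p′ q z≡pr z≡p′q pal-r pal-q r<q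
    with shorter-suffix p r p′ q (trans (sym z≡pr) z≡p′q) (<⇒≤ r<q)
  ... | m , q≡mr = reverse m , trans z≡p′q (cong (p′ ++_) q≡r·m̃) , nonempty m q≡mr
    where
    q≡r·m̃ : q ≡ r ++ reverse m
    q≡r·m̃ = begin
      q                       ≡⟨ pal-q ⟨
      reverse q               ≡⟨ cong reverse q≡mr ⟩
      reverse (m ++ r)        ≡⟨ reverse-++ m r ⟩
      reverse r ++ reverse m  ≡⟨ cong (_++ reverse m) pal-r ⟩
      r ++ reverse m          ∎
      where open ≡-Reasoning
    nonempty : ∀ m → q ≡ m ++ r → 1 ≤ length (reverse m)
    nonempty [] q≡r = ⊥-elim (<-irrefl (cong length (sym q≡r)) r<q)
    nonempty (y ∷ m′) _ = subst (1 ≤_) (sym (length-reverse (y ∷ m′))) (s≤s z≤n)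

  LpsOccurrence : List A → List A → Set
  LpsOccurrence r w = Σ (List A) λ p′ → Σ (List A) λ s′ → (w ≡ p′ ++ r ++ s′) × lps (p′ ++ r) ≡ r

  -- Every palindromic factor has such an occurrence: while a longer palindromic suffix
  -- ends at the current occurrence, mirroring yields a strictly earlier occurrence.
  -- This is why a word of length n has at most n + 1 palindromic factors.
  first-occurrence : ∀ w p r s → w ≡ p ++ r ++ s → Pal r → LpsOccurrence r w
  first-occurrence w p r s = go (suc (length p)) p s ≤-refl
    where
    go : ∀ n p s → length p < n → w ≡ p ++ r ++ s → Pal r → LpsOccurrence r w
    go (suc n) p s p<n w≡prs pal-r
      with lps-suffix (p ++ r) | m≤n⇒m<n∨m≡n (lps-longest (p ++ r) p r refl pal-r)
    ... | p′ , pr≡p′l | inj₁ r<l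
      with mirror-in-longer (p ++ r) p r p′ (lps (p ++ r)) refl pr≡p′l pal-r (lps-pal (p ++ r)) r<l
    ... | m , pr≡p′rm , 1≤m = go n p′ (m ++ s) p′<n w≡p′rms pal-r
      where
      w≡p′rms : w ≡ p′ ++ r ++ m ++ s
      w≡p′rms = begin
        w                    ≡⟨ w≡prs ⟩
        p ++ r ++ s          ≡⟨ ++-assoc p r s ⟨
        (p ++ r) ++ s        ≡⟨ cong (_++ s) pr≡p′rm ⟩
        (p′ ++ r ++ m) ++ s  ≡⟨ ++-assoc p′ (r ++ m) s ⟩
        p′ ++ (r ++ m) ++ s  ≡⟨ cong (p′ ++_) (++-assoc r m s) ⟩
        p′ ++ r ++ m ++ s    ∎
        where open ≡-Reasoning
      lengths : length p + length r ≡ length p′ + (length r + length m)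
      lengths = trans (sym (length-++ p)) (trans (cong length pr≡p′rm)
                  (trans (length-++ p′) (cong (length p′ +_) (length-++ r))))
      p′<p : length p′ < length p
      p′<p = +-cancelʳ-≤ (length r) (suc (length p′)) (length p) (begin
        suc (length p′) + length r          ≡⟨ +-suc (length p′) (length r) ⟨
        length p′ + (1 + length r)          ≡⟨ cong (length p′ +_) (+-comm 1 (length r)) ⟩
        length p′ + (length r + 1)          ≤⟨ +-monoʳ-≤ (length p′) (+-monoʳ-≤ (length r) 1≤m) ⟩
        length p′ + (length r + length m)   ≡⟨ lengths ⟨
        length p + length r                ∎)
        where open ≤-Reasoning
      p′<n : length p′ < n
      p′<n = ≤-trans p′<p (s≤s⁻¹ p<n)
    go (suc n) p s p<n w≡prs pal-r | p′ , pr≡p′l | inj₂ r≡l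
      with shorter-suffix p r p′ (lps (p ++ r)) pr≡p′l (≤-reflexive r≡l)
    ... | [] , l≡r = p , s , w≡prs , l≡r
    ... | y ∷ m , l≡ymr = ⊥-elim (<-irrefl r≡l
          (subst (λ l → length r < length l) (sym l≡ymr) (s≤s (length-++-≤ʳ r {m}))))

  pal-last : ∀ {y} p → Pal (y ∷ p) → y ∷ p ≡ reverse p ++ [ y ]
  pal-last {y} p pal = trans (sym pal) (unfold-reverse y p)

module Morphism {A : Set} (_≟_ : DecidableEquality A) (a : A) where
  open Palindromes _≟_

  Ψ : List A → List A
  Ψ = ψ _≟_ a

  Ψ-++ : ∀ v w → Ψ (v ++ w) ≡ Ψ v ++ Ψ w
  Ψ-++ [] w = refl
  Ψ-++ (x ∷ v) w = trans (cong (_ ++_) (Ψ-++ v w)) (sym (++-assoc _ (Ψ v) (Ψ w)))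

  a-or-other : ∀ x → x ≡ a ⊎ ¬ x ≡ a
  a-or-other x with x ≟ a
  ... | yes x≡a = inj₁ x≡a
  ... | no x≢a = inj₂ x≢a

  Ψ-a∷ : ∀ w → Ψ (a ∷ w) ≡ a ∷ Ψ w
  Ψ-a∷ w with a ≟ a
  ... | yes _ = refl
  ... | no a≢a = ⊥-elim (a≢a refl)

  Ψ-other∷ : ∀ {x} w → ¬ x ≡ a → Ψ (x ∷ w) ≡ a ∷ x ∷ Ψ w
  Ψ-other∷ {x} w x≢a with x ≟ a
  ... | yes x≡a = ⊥-elim (x≢a x≡a)
  ... | no _ = refl

  -- The closed image U(w) = ψ_a(w)·a: the image of a factor w of t followed by the
  -- first letter a of the image of the next letter.  U commutes with reversal.
  U : List A → List A
  U w = Ψ w ++ [ a ]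

  U-a∷ : ∀ w → U (a ∷ w) ≡ a ∷ U w
  U-a∷ w = cong (_++ [ a ]) (Ψ-a∷ w)

  U-other∷ : ∀ {x} w → ¬ x ≡ a → U (x ∷ w) ≡ a ∷ x ∷ U w
  U-other∷ w x≢a = cong (_++ [ a ]) (Ψ-other∷ w x≢a)

  Ψ-starts-a : ∀ x w → Σ (List A) λ t → Ψ (x ∷ w) ≡ a ∷ t
  Ψ-starts-a x w with a-or-other x
  ... | inj₁ refl = Ψ w , Ψ-a∷ w
  ... | inj₂ x≢a = x ∷ Ψ w , Ψ-other∷ w x≢a

  U-starts-a : ∀ w → Σ (List A) λ t → U w ≡ a ∷ t
  U-starts-a [] = [] , refl
  U-starts-a (x ∷ w) with Ψ-starts-a x w
  ... | t , Ψ≡ = t ++ [ a ] , cong (_++ [ a ]) Ψ≡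

  U-head : ∀ w {y t} → U w ≡ y ∷ t → y ≡ a
  U-head w U≡ = ∷-injectiveˡ (trans (sym U≡) (proj₂ (U-starts-a w)))

  -- ψ_a is injective (a letter x ≠ a is recognised as the factor a·x), hence so is U.
  Ψ-injective : ∀ v w → Ψ v ≡ Ψ w → v ≡ w
  Ψ-injective [] [] _ = refl
  Ψ-injective [] (y ∷ w) eq = ⊥-elim ([]≢∷ (trans eq (proj₂ (Ψ-starts-a y w))))
    where []≢∷ : ∀ {t : List A} → ¬ ([] ≡ a ∷ t)
          []≢∷ ()
  Ψ-injective (x ∷ v) [] eq = sym (Ψ-injective [] (x ∷ v) (sym eq))
  Ψ-injective (x ∷ v) (y ∷ w) eq with a-or-other x | a-or-other y
  ... | inj₁ refl | inj₁ refl =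
    cong (a ∷_) (Ψ-injective v w (∷-injectiveʳ (trans (sym (Ψ-a∷ v)) (trans eq (Ψ-a∷ w)))))
  ... | inj₁ refl | inj₂ y≢a = ⊥-elim (y≢a (U-head v (cong (_++ [ a ])
          (∷-injectiveʳ (trans (sym (Ψ-a∷ v)) (trans eq (Ψ-other∷ w y≢a)))))))
  ... | inj₂ x≢a | inj₁ refl = ⊥-elim (x≢a (U-head w (cong (_++ [ a ])
          (∷-injectiveʳ (trans (sym (Ψ-a∷ w)) (trans (sym eq) (Ψ-other∷ v x≢a)))))))
  ... | inj₂ x≢a | inj₂ y≢a
    with ∷-injective (∷-injectiveʳ (trans (sym (Ψ-other∷ v x≢a)) (trans eq (Ψ-other∷ w y≢a))))
  ... | refl , Ψv≡Ψw = cong (x ∷_) (Ψ-injective v w Ψv≡Ψw)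

  U-injective : ∀ v w → U v ≡ U w → v ≡ w
  U-injective v w eq = Ψ-injective v w (++-cancelʳ [ a ] (Ψ v) (Ψ w) eq)

  U-reverse : ∀ v → reverse (U v) ≡ U (reverse v)
  U-reverse v = trans (reverse-++ (Ψ v) [ a ]) (a·reverse v)
    where
    open ≡-Reasoning
    letter : ∀ x → a ∷ reverse (Ψ [ x ]) ≡ U [ x ]
    letter x with a-or-other x
    ... | inj₁ refl = trans (cong (λ z → a ∷ reverse z) (Ψ-a∷ []))
                            (cong (_++ [ a ]) (sym (Ψ-a∷ [])))
    ... | inj₂ x≢a = trans (cong (λ z → a ∷ reverse z) (Ψ-other∷ [] x≢a))
                           (cong (_++ [ a ]) (sym (Ψ-other∷ [] x≢a)))
    a·reverse : ∀ v → a ∷ reverse (Ψ v) ≡ U (reverse v)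
    a·reverse [] = refl
    a·reverse (x ∷ v) = begin
      a ∷ reverse (Ψ ([ x ] ++ v))             ≡⟨ cong (λ z → a ∷ reverse z) (Ψ-++ [ x ] v) ⟩
      a ∷ reverse (Ψ [ x ] ++ Ψ v)             ≡⟨ cong (a ∷_) (reverse-++ (Ψ [ x ]) (Ψ v)) ⟩
      (a ∷ reverse (Ψ v)) ++ reverse (Ψ [ x ]) ≡⟨ cong (_++ reverse (Ψ [ x ])) (a·reverse v) ⟩
      (Ψ (reverse v) ++ [ a ]) ++ reverse (Ψ [ x ]) ≡⟨ ++-assoc (Ψ (reverse v)) [ a ] _ ⟩
      Ψ (reverse v) ++ a ∷ reverse (Ψ [ x ])   ≡⟨ cong (Ψ (reverse v) ++_) (letter x) ⟩
      Ψ (reverse v) ++ Ψ [ x ] ++ [ a ]        ≡⟨ ++-assoc (Ψ (reverse v)) (Ψ [ x ]) [ a ] ⟨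
      (Ψ (reverse v) ++ Ψ [ x ]) ++ [ a ]      ≡⟨ cong (_++ [ a ]) (Ψ-++ (reverse v) [ x ]) ⟨
      U (reverse v ++ [ x ])                   ≡⟨ cong U (unfold-reverse x v) ⟨
      U (reverse (x ∷ v))                      ∎

  U-pal : ∀ v → Pal (U v) → Pal v
  U-pal v pal = U-injective (reverse v) v (trans (sym (U-reverse v)) pal)

  nonA : List A → ℕ
  nonA [] = 0
  nonA (x ∷ w) with a-or-other x
  ... | inj₁ _ = nonA w
  ... | inj₂ _ = suc (nonA w)

  Ψ-length : ∀ w → length (Ψ w) ≡ nonA w + length w
  Ψ-length [] = refl
  Ψ-length (x ∷ w) with a-or-other x
  ... | inj₁ refl = trans (cong length (Ψ-a∷ w)) (trans (cong suc (Ψ-length w)) (sym (+-suc _ _)))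
  ... | inj₂ x≢a = trans (cong length (Ψ-other∷ w x≢a))
                     (cong suc (trans (cong suc (Ψ-length w)) (sym (+-suc _ _))))

  U-length : ∀ w → length (U w) ≡ nonA w + suc (length w)
  U-length w = begin
    length (Ψ w ++ [ a ])       ≡⟨ length-++ (Ψ w) ⟩
    length (Ψ w) + 1            ≡⟨ cong (_+ 1) (Ψ-length w) ⟩
    nonA w + length w + 1       ≡⟨ +-assoc (nonA w) (length w) 1 ⟩
    nonA w + (length w + 1)     ≡⟨ cong (nonA w +_) (+-comm (length w) 1) ⟩
    nonA w + suc (length w)     ∎
    where open ≡-Reasoning

  nonAPrefixes : List A → List (List A)
  nonAPrefixes [] = []
  nonAPrefixes (x ∷ w) with a-or-other x
  ... | inj₁ _ = map (x ∷_) (nonAPrefixes w)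
  ... | inj₂ _ = [ x ] ∷ map (x ∷_) (nonAPrefixes w)

  length-nonAPrefixes : ∀ w → length (nonAPrefixes w) ≡ nonA w
  length-nonAPrefixes [] = refl
  length-nonAPrefixes (x ∷ w) with a-or-other x
  ... | inj₁ _ = trans (length-map (x ∷_) (nonAPrefixes w)) (length-nonAPrefixes w)
  ... | inj₂ _ = cong suc (trans (length-map (x ∷_) (nonAPrefixes w)) (length-nonAPrefixes w))

  nonAPrefixes-∈ : ∀ p y s → ¬ y ≡ a → p ++ [ y ] ∈ nonAPrefixes (p ++ y ∷ s)
  nonAPrefixes-∈ [] y s y≢a with a-or-other y
  ... | inj₁ y≡a = ⊥-elim (y≢a y≡a)
  ... | inj₂ _ = here refl
  nonAPrefixes-∈ (x ∷ p) y s y≢a with a-or-other x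
  ... | inj₁ _ = ∈-map⁺ (x ∷_) (nonAPrefixes-∈ p y s y≢a)
  ... | inj₂ _ = there (∈-map⁺ (x ∷_) (nonAPrefixes-∈ p y s y≢a))

  other-isolated : ∀ w α {c β} → U w ≡ α ++ c ∷ β → ¬ c ≡ a →
    (Σ (List A) λ α′ → α ≡ α′ ++ [ a ]) × (Σ (List A) λ β′ → β ≡ a ∷ β′)
  other-isolated [] [] refl c≢a = ⊥-elim (c≢a refl)
  other-isolated [] (y ∷ α) eq c≢a = ⊥-elim ([]≢++∷ α (∷-injectiveʳ eq))
  other-isolated (x ∷ w) α eq c≢a with a-or-other x
  other-isolated (x ∷ w) α eq c≢a | inj₁ refl with α | trans (sym (U-a∷ w)) eq
  ... | [] | eq′ = ⊥-elim (c≢a (sym (∷-injectiveˡ eq′)))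
  ... | y ∷ α′ | eq′ with ∷-injective eq′
  ... | refl , eq″ with other-isolated w α′ eq″ c≢a
  ... | (α″ , refl) , after = (y ∷ α″ , refl) , after
  other-isolated (x ∷ w) α eq c≢a | inj₂ x≢a with α | trans (sym (U-other∷ w x≢a)) eq
  ... | [] | eq′ = ⊥-elim (c≢a (sym (∷-injectiveˡ eq′)))
  ... | y ∷ [] | eq′ with ∷-injective eq′
  ... | refl , eq″ with ∷-injective eq″
  ... | refl , refl = ([] , refl) , U-starts-a w
  other-isolated (x ∷ w) α eq c≢a | inj₂ x≢a | y ∷ z ∷ α′ | eq′ with ∷-injective eq′
  ... | refl , eq″ with ∷-injective eq″
  ... | refl , eq‴ with other-isolated w α′ eq‴ c≢a
  ... | (α″ , refl) , after = (y ∷ z ∷ α″ , refl) , after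

  decode-prefix : ∀ w g {β} → U w ≡ g ++ a ∷ β →
    Σ (List A) λ v → Σ (List A) λ w₂ → (w ≡ v ++ w₂) × g ≡ Ψ v
  decode-prefix w [] eq = [] , w , refl , refl
  decode-prefix [] (y ∷ g) eq = ⊥-elim ([]≢++∷ g (∷-injectiveʳ eq))
  decode-prefix (x ∷ w) (y ∷ g) eq with a-or-other x
  decode-prefix (x ∷ w) (y ∷ g) eq | inj₁ refl with ∷-injective (trans (sym (U-a∷ w)) eq)
  ... | refl , eq′ with decode-prefix w g eq′
  ... | v , w₂ , refl , refl = a ∷ v , w₂ , refl , sym (Ψ-a∷ v)
  decode-prefix (x ∷ w) (y ∷ g) eq | inj₂ x≢a with ∷-injective (trans (sym (U-other∷ w x≢a)) eq)
  decode-prefix (x ∷ w) (y ∷ []) eq | inj₂ x≢a | refl , eq′ = ⊥-elim (x≢a (∷-injectiveˡ eq′))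
  decode-prefix (x ∷ w) (y ∷ z ∷ g) eq | inj₂ x≢a | refl , eq′ with ∷-injective eq′
  ... | refl , eq″ with decode-prefix w g eq″
  ... | v , w₂ , refl , refl = x ∷ v , w₂ , refl , sym (Ψ-other∷ v x≢a)

  -- words that can begin at a cut between images of letters
  EmptyOrStartsA : List A → Set
  EmptyOrStartsA g = g ≡ [] ⊎ Σ (List A) λ g′ → g ≡ a ∷ g′

  decode-factor : ∀ w α g {β} → EmptyOrStartsA g → U w ≡ α ++ g ++ a ∷ β →
    Σ (List A) λ w₁ → Σ (List A) λ v → Σ (List A) λ w₂ → (w ≡ w₁ ++ v ++ w₂) × g ≡ Ψ v
  decode-factor w [] g _ eq with decode-prefix w g eq
  ... | v , w₂ , w≡ , g≡ = [] , v , w₂ , w≡ , g≡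
  decode-factor [] (y ∷ α) g _ eq =
    ⊥-elim ([]≢++∷ (α ++ g) (trans (∷-injectiveʳ eq) (sym (++-assoc α g _))))
  decode-factor (x ∷ w) (y ∷ α) g cut eq with a-or-other x
  decode-factor (x ∷ w) (y ∷ α) g cut eq | inj₁ refl with ∷-injective (trans (sym (U-a∷ w)) eq)
  ... | refl , eq′ with decode-factor w α g cut eq′
  ... | w₁ , v , w₂ , refl , g≡ = a ∷ w₁ , v , w₂ , refl , g≡
  decode-factor (x ∷ w) (y ∷ α) g cut eq | inj₂ x≢a with ∷-injective (trans (sym (U-other∷ w x≢a)) eq)
  decode-factor (x ∷ w) (y ∷ []) .[] (inj₁ refl) eq | inj₂ x≢a | refl , eq′ =
    ⊥-elim (x≢a (∷-injectiveˡ eq′))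
  decode-factor (x ∷ w) (y ∷ []) g (inj₂ (g′ , refl)) eq | inj₂ x≢a | refl , eq′ =
    ⊥-elim (x≢a (∷-injectiveˡ eq′))
  decode-factor (x ∷ w) (y ∷ z ∷ α) g cut eq | inj₂ x≢a | refl , eq′ with ∷-injective eq′
  ... | refl , eq″ with decode-factor w α g cut eq″
  ... | w₁ , v , w₂ , refl , g≡ = x ∷ w₁ , v , w₂ , refl , g≡

  -- A palindromic factor of U(w) starting with a is U(v) for a palindromic factor v of w:
  -- it ends with a, so removing that a leaves an image ψ_a(v) of a factor v of w.
  pal-starting-with-a : ∀ w p → Pal (a ∷ p) → Factor (a ∷ p) (U w) →
    Σ (List A) λ v → Pal v × Factor v w × a ∷ p ≡ U v
  pal-starting-with-a w p pal (α , β , U≡) with decode-factor w α g cut U≡′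
    where
    g : List A
    g = reverse p
    cut : EmptyOrStartsA g
    cut with g | pal-last p pal
    ... | [] | _ = inj₁ refl
    ... | z ∷ g′ | a∷p≡ = inj₂ (g′ , cong (_∷ g′) (sym (∷-injectiveˡ a∷p≡)))
    U≡′ : U w ≡ α ++ g ++ a ∷ β
    U≡′ = trans U≡ (cong (α ++_) (trans (cong (_++ β) (pal-last p pal)) (++-assoc g [ a ] β)))
  ... | w₁ , v , w₂ , w≡ , g≡ =
    v , U-pal v (trans (cong reverse (sym a∷p≡Uv)) (trans pal a∷p≡Uv)) , (w₁ , w₂ , w≡) , a∷p≡Uv
    where
    a∷p≡Uv : a ∷ p ≡ U v
    a∷p≡Uv = trans (pal-last p pal) (cong (_++ [ a ]) g≡)

  -- A palindromic factor y·p of U(w) with y ≠ a is surrounded by a's; a·y·p·a is then a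
  -- palindromic U-image, so p = ψ_a(r) for a palindromic factor y·r of w.
  pal-starting-with-other : ∀ w {y} p → ¬ y ≡ a → Pal (y ∷ p) → Factor (y ∷ p) (U w) →
    Σ (List A) λ r → Pal (y ∷ r) × Factor (y ∷ r) w × p ≡ Ψ r
  pal-starting-with-other w {y} p y≢a pal (α , β , U≡) with
    other-isolated w α U≡ y≢a | other-isolated w (α ++ reverse p) U≡-last y≢a
    where
    U≡-last : U w ≡ (α ++ reverse p) ++ y ∷ β
    U≡-last = begin
      U w                          ≡⟨ U≡ ⟩
      α ++ (y ∷ p) ++ β            ≡⟨ cong (λ z → α ++ z ++ β) (pal-last p pal) ⟩
      α ++ (reverse p ++ [ y ]) ++ β ≡⟨ cong (α ++_) (++-assoc (reverse p) [ y ] β) ⟩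
      α ++ reverse p ++ y ∷ β      ≡⟨ ++-assoc α (reverse p) (y ∷ β) ⟨
      (α ++ reverse p) ++ y ∷ β    ∎
      where open ≡-Reasoning
  ... | (α′ , refl) , _ | _ , (β′ , refl) with
    pal-starting-with-a w (y ∷ p ++ [ a ]) pal′ (α′ , β′ , U≡″)
    where
    U≡″ : U w ≡ α′ ++ (a ∷ y ∷ p ++ [ a ]) ++ β′
    U≡″ = trans U≡ (trans (++-assoc α′ [ a ] _)
                          (cong (λ z → α′ ++ a ∷ z) (sym (++-assoc (y ∷ p) [ a ] β′))))
    pal′ : Pal (a ∷ y ∷ p ++ [ a ])
    pal′ = begin
      reverse (a ∷ (y ∷ p) ++ [ a ])   ≡⟨ unfold-reverse a ((y ∷ p) ++ [ a ]) ⟩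
      reverse ((y ∷ p) ++ [ a ]) ++ [ a ] ≡⟨ cong (_++ [ a ]) (reverse-++ (y ∷ p) [ a ]) ⟩
      a ∷ reverse (y ∷ p) ++ [ a ]     ≡⟨ cong (λ z → a ∷ z ++ [ a ]) pal ⟩
      a ∷ (y ∷ p) ++ [ a ]             ∎
      where open ≡-Reasoning
  ... | v , pal-v , fac-v , a∷y∷p·a≡Uv =
    decode v pal-v fac-v (++-cancelʳ [ a ] _ (Ψ v) a∷y∷p·a≡Uv)
    where
    decode : ∀ v → Pal v → Factor v w → a ∷ y ∷ p ≡ Ψ v →
             Σ (List A) λ r → Pal (y ∷ r) × Factor (y ∷ r) w × p ≡ Ψ r
    decode [] _ _ ()
    decode (x ∷ r) pal-v fac-v a∷y∷p≡ with a-or-other x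
    ... | inj₁ refl = ⊥-elim (y≢a (U-head r (cong (_++ [ a ])
                        (sym (∷-injectiveʳ (trans a∷y∷p≡ (Ψ-a∷ r)))))))
    ... | inj₂ x≢a with ∷-injective (∷-injectiveʳ (trans a∷y∷p≡ (Ψ-other∷ r x≢a)))
    ... | refl , p≡ = r , pal-v , fac-v , p≡

  -- Every palindromic factor y·r of w with y ≠ a is the longest palindromic suffix of a
  -- prefix of w ending with a non-a letter (the prefix ending at its first occurrence).
  pal-is-lps-at-nonA : ∀ w {y} r → ¬ y ≡ a → Pal (y ∷ r) → Factor (y ∷ r) w →
    Σ (List A) λ u → u ∈ nonAPrefixes w × lps u ≡ y ∷ r
  pal-is-lps-at-nonA w {y} r y≢a pal (p , s , w≡)
    with first-occurrence w p (y ∷ r) s w≡ pal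
  ... | p′ , s′ , w≡′ , lps≡ = p′ ++ y ∷ r , u∈ , lps≡
    where
    q : List A
    q = p′ ++ reverse r
    q·y≡ : q ++ [ y ] ≡ p′ ++ y ∷ r
    q·y≡ = trans (++-assoc p′ (reverse r) [ y ]) (cong (p′ ++_) (sym (pal-last r pal)))
    w≡q·y·s′ : w ≡ q ++ y ∷ s′
    w≡q·y·s′ = begin
      w                                 ≡⟨ w≡′ ⟩
      p′ ++ (y ∷ r) ++ s′               ≡⟨ cong (λ z → p′ ++ z ++ s′) (pal-last r pal) ⟩
      p′ ++ (reverse r ++ [ y ]) ++ s′  ≡⟨ cong (p′ ++_) (++-assoc (reverse r) [ y ] s′) ⟩
      p′ ++ reverse r ++ y ∷ s′         ≡⟨ ++-assoc p′ (reverse r) (y ∷ s′) ⟨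
      q ++ y ∷ s′                       ∎
      where open ≡-Reasoning
    u∈ : p′ ++ y ∷ r ∈ nonAPrefixes w
    u∈ = subst₂ (λ u v → u ∈ nonAPrefixes v) q·y≡ (sym w≡q·y·s′) (nonAPrefixes-∈ q y s′ y≢a)

  candidates : List A → List (List A)
  candidates w = [] ∷ (map U (PAL _≟_ w) ++ map (λ u → drop 1 (Ψ (lps u))) (nonAPrefixes w))

  PAL-U⊆candidates : ∀ w {p} → p ∈ PAL _≟_ (U w) → p ∈ candidates w
  PAL-U⊆candidates w {p} p∈ with PAL⁻ (U w) p∈
  PAL-U⊆candidates w {[]} p∈ | _ = here refl
  PAL-U⊆candidates w {y ∷ p} p∈ | pal , fac with a-or-other y
  ... | inj₁ refl with pal-starting-with-a w p pal fac
  ... | v , pal-v , fac-v , p≡ =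
    there (∈-++⁺ˡ (subst (_∈ map U (PAL _≟_ w)) (sym p≡) (∈-map⁺ U (PAL⁺ w pal-v fac-v))))
  PAL-U⊆candidates w {y ∷ p} p∈ | pal , fac | inj₂ y≢a
    with pal-starting-with-other w p y≢a pal fac
  ... | r , pal-r , fac-r , p≡ with pal-is-lps-at-nonA w r y≢a pal-r fac-r
  ... | u , u∈ , lps≡ = there (∈-++⁺ʳ (map U (PAL _≟_ w))
          (subst (_∈ map tailΨlps (nonAPrefixes w)) y∷p≡ (∈-map⁺ tailΨlps u∈)))
    where
    tailΨlps : List A → List A
    tailΨlps u = drop 1 (Ψ (lps u))
    y∷p≡ : tailΨlps u ≡ y ∷ p
    y∷p≡ = trans (cong (λ z → drop 1 (Ψ z)) lps≡)
             (trans (cong (drop 1) (Ψ-other∷ r y≢a)) (cong (y ∷_) (sym p≡)))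

  PAL-U-bound : ∀ w → length (PAL _≟_ (U w)) ≤ suc (nonA w + length (PAL _≟_ w))
  PAL-U-bound w = begin
    length (PAL _≟_ (U w))
      ≤⟨ unique-⊆⇒length-≤ _ (candidates w) (PAL-unique (U w)) (PAL-U⊆candidates w) ⟩
    length (candidates w)   ≡⟨ cong suc (length-++ (map U (PAL _≟_ w))) ⟩
    suc (length (map U (PAL _≟_ w)) + length (map _ (nonAPrefixes w)))
      ≡⟨ cong suc (cong₂ _+_ (length-map U (PAL _≟_ w))
                    (trans (length-map _ (nonAPrefixes w)) (length-nonAPrefixes w))) ⟩
    suc (length (PAL _≟_ w) + nonA w) ≡⟨ cong suc (+-comm (length (PAL _≟_ w)) (nonA w)) ⟩
    suc (nonA w + length (PAL _≟_ w)) ∎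
    where open ≤-Reasoning

  defect-U : ∀ w → D _≟_ w ≤ D _≟_ (U w)
  defect-U w = begin
    suc (length w) ∸ |PALw|                   ≡⟨ [m+n]∸[m+o]≡n∸o (nonA w) (suc (length w)) |PALw| ⟨
    (nonA w + suc (length w)) ∸ (nonA w + |PALw|) ≡⟨ cong (_∸ (nonA w + |PALw|)) (U-length w) ⟨
    suc (length (U w)) ∸ suc (nonA w + |PALw|) ≤⟨ ∸-monoʳ-≤ (suc (length (U w))) (PAL-U-bound w) ⟩
    suc (length (U w)) ∸ length (PAL _≟_ (U w)) ∎
    where
    open ≤-Reasoning
    |PALw| : ℕ
    |PALw| = length (PAL _≟_ w)

module InfiniteWords {A : Set} (_≟_ : DecidableEquality A) where

  sl : (ℕ → A) → ℕ → ℕ → List A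
  sl = slice _≟_

  slice-length : ∀ x i n → length (sl x i n) ≡ n
  slice-length x i n = length-tabulate _

  slice-suc : ∀ x i n → sl x i (suc n) ≡ x i ∷ sl x (suc i) n
  slice-suc x i n =
    cong₂ _∷_ (cong x (+-identityʳ i)) (tabulate-cong (λ k → cong x (+-suc i (toℕ k))))

  slice-++ : ∀ x i m n → sl x i (m + n) ≡ sl x i m ++ sl x (i + m) n
  slice-++ x i zero n = cong (λ j → sl x j n) (sym (+-identityʳ i))
  slice-++ x i (suc m) n = begin
    sl x i (suc m + n)                        ≡⟨ slice-suc x i (m + n) ⟩
    x i ∷ sl x (suc i) (m + n)                ≡⟨ cong (x i ∷_) (slice-++ x (suc i) m n) ⟩
    x i ∷ sl x (suc i) m ++ sl x (suc i + m) n ≡⟨ cong (λ j → x i ∷ sl x (suc i) m ++ sl x j n) (+-suc i m) ⟨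
    x i ∷ sl x (suc i) m ++ sl x (i + suc m) n ≡⟨ cong (_++ sl x (i + suc m) n) (slice-suc x i m) ⟨
    sl x i (suc m) ++ sl x (i + suc m) n      ∎
    where open ≡-Reasoning

  factor-of-prefix : ∀ x (X Y W : List A) → prefix _≟_ x (length (X ++ Y ++ W)) ≡ X ++ Y ++ W →
                     sl x (length X) (length Y) ≡ Y
  factor-of-prefix x X Y W pre≡ =
    proj₁ (++-split (sl x (length X) (length Y)) Y _ W (slice-length x _ _)
      (proj₂ (++-split (sl x 0 (length X)) X _ (Y ++ W) (slice-length x 0 _) read≡)))
    where
    read≡ : sl x 0 (length X) ++ sl x (length X) (length Y) ++ sl x (length X + length Y) (length W)
            ≡ X ++ Y ++ W
    read≡ = begin
      sl x 0 (length X) ++ sl x (length X) (length Y) ++ sl x (length X + length Y) (length W)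
        ≡⟨ cong (sl x 0 (length X) ++_) (slice-++ x (length X) (length Y) (length W)) ⟨
      sl x 0 (length X) ++ sl x (length X) (length Y + length W)
        ≡⟨ slice-++ x 0 (length X) _ ⟨
      sl x 0 (length X + (length Y + length W))
        ≡⟨ cong (sl x 0) (trans (length-++ X) (cong (length X +_) (length-++ Y))) ⟨
      prefix _≟_ x (length (X ++ Y ++ W))
        ≡⟨ pre≡ ⟩
      X ++ Y ++ W ∎
      where open ≡-Reasoning

module ImageFactors {A : Set} (_≟_ : DecidableEquality A) (a : A) where
  open Morphism _≟_ a
  open InfiniteWords _≟_

  -- If s = ψ_a(t), then for every factor w of t the closed image U(w) is a factor of s:
  -- w is followed in t by some letter x, and ψ_a(x) starts with a.
  factor-U : ∀ t s → IsPsiImage _≟_ a t s → ∀ w → IsFactor _≟_ w t → IsFactor _≟_ (U w) s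
  factor-U t s s≡ψt w (i , w≡) with Ψ-starts-a (t (i + length w)) []
  ... | rest , Ψx≡ = length (Ψ before) , factor-of-prefix s (Ψ before) (U w) rest image≡
    where
    before : List A
    before = sl t 0 i
    x : A
    x = t (i + length w)
    n : ℕ
    n = i + (length w + 1)
    prefix≡ : prefix _≟_ t n ≡ before ++ w ++ [ x ]
    prefix≡ = trans (slice-++ t 0 i (length w + 1)) (cong (before ++_) (trans (slice-++ t i (length w) 1)
                (cong₂ _++_ w≡ (cong (_∷ []) (cong t (+-identityʳ (i + length w)))))))
    Ψprefix≡ : Ψ (prefix _≟_ t n) ≡ Ψ before ++ U w ++ rest
    Ψprefix≡ = begin
      Ψ (prefix _≟_ t n)               ≡⟨ cong Ψ prefix≡ ⟩
      Ψ (before ++ w ++ [ x ])         ≡⟨ Ψ-++ before (w ++ [ x ]) ⟩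
      Ψ before ++ Ψ (w ++ [ x ])       ≡⟨ cong (Ψ before ++_) (Ψ-++ w [ x ]) ⟩
      Ψ before ++ Ψ w ++ Ψ [ x ]       ≡⟨ cong (λ z → Ψ before ++ Ψ w ++ z) Ψx≡ ⟩
      Ψ before ++ Ψ w ++ a ∷ rest      ≡⟨ cong (Ψ before ++_) (++-assoc (Ψ w) [ a ] rest) ⟨
      Ψ before ++ U w ++ rest          ∎
      where open ≡-Reasoning
    image≡ : prefix _≟_ s (length (Ψ before ++ U w ++ rest)) ≡ Ψ before ++ U w ++ rest
    image≡ = subst (λ z → prefix _≟_ s (length z) ≡ z) Ψprefix≡ (s≡ψt n)

-- The theorem: each factor w of t is dominated by the factor U(w) of s, both for the
-- defect comparison and for bounds on the defect.
proposition5p13 : {A : Set} (_≟_ : DecidableEquality A)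
    (alphabet : List A) → (∀ x → x ∈ alphabet) →
    (t s : ℕ → A) (a : A) → IsPsiImage _≟_ a t s →
    DefectGE _≟_ s t × (AlmostRich _≟_ s → AlmostRich _≟_ t)
proposition5p13 _≟_ _ _ t s a s≡ψt = defect-grows , almost-rich-descends
  where
  open Morphism _≟_ a using (U; defect-U)
  open ImageFactors _≟_ a using (factor-U)
  defect-grows : DefectGE _≟_ s t
  defect-grows w w-in-t = U w , factor-U t s s≡ψt w w-in-t , defect-U w
  almost-rich-descends : AlmostRich _≟_ s → AlmostRich _≟_ t
  almost-rich-descends (B , bounded) =
    B , λ w w-in-t → ≤-trans (defect-U w) (bounded (U w) (factor-U t s s≡ψt w w-in-t))
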